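{- Let $l > n \geq 2$ be integers, $I = \{0,\ldots,n-1\}$, $\phi_i(x) = (x+i)/l$. For $k \geq 1$ and $1 \leq i \leq k$, every gap of type $(i,k)$ has length $$\frac{l-n}{l^k}\left(1 + l + l^2 + \cdots + l^{i-1}\right).$$
   Context: A level-$k$ basic interval is $\phi_{\omega_1}\circ\cdots\circ\phi_{\omega_k}([0,1])$ with $\omega \in I^k$; $O_k$ is the union of all level-$k$ basic intervals. Clusters: for $0 \le i \le k$, a cluster of type $(i,k)$ is a set $\bigcup_{\omega_1\cdots\omega_i \in I^i}\phi_{\tau_1}\circ\cdots\circ\phi_{\tau_{k-i}}\circ\phi_{\omega_1}\circ\cdots\circ\phi_{\omega_i}([0,1])$ for some fixed $\tau \in I^{k-i}$ (so type-$(0,k)$ clusters are the level-$k$ basic intervals and the unique type-$(k,k)$ cluster is $O_k$). The level-$k$ gap intervals are the connected components of $[0,1] \setminus O_k$. The gap of type $(k,k)$ is the gap between $O_k$ and the right endpoint $1$. For $1 \le i \le k-1$, each type-$(i+1,k)$ cluster is the union of $n$ type-$(i,k)$ clusters (obtained by fixing one more prefix letter), and the $n-1$ gap intervals separating consecutive type-$(i,k)$ clusters inside one type-$(i+1,k)$ cluster are called gaps of type $(i,k)$. -}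

module Defs where

open import Data.Nat using (ℕ; zero; suc; _^_)
open import Data.Fin using (Fin; toℕ)
open import Data.List using (List; []; _∷_; _++_; map; foldr; concatMap; allFin; upTo)
open import Data.Nat.ListAction using (sum)
open import Data.Integer using (+_)
open import Data.Rational using (ℚ; _/_; _+_; _*_; _-_; _⊔_; _⊓_; 0ℚ; 1ℚ)

-- the rational number 1/m (only used for m ≥ 1; the value at 0 is an irrelevant convention)
recip : ℕ → ℚ
recip zero    = 0ℚ
recip (suc m) = + 1 / suc m

ℕtoℚ : ℕ → ℚ
ℕtoℚ m = + m / 1

φ : (l i : ℕ) → ℚ → ℚ
φ l i x = (x + ℕtoℚ i) * recip l

Word : ℕ → Set
Word n = List (Fin n)

applyWord : (l : ℕ) {n : ℕ} → Word n → ℚ → ℚ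
applyWord l ω x = foldr (λ d y → φ l (toℕ d) y) x ω

-- Each φ_i is increasing affine, so φ_ω([0,1]) = [φ_ω(0), φ_ω(1)].
leftEnd : (l : ℕ) {n : ℕ} → Word n → ℚ
leftEnd l ω = applyWord l ω 0ℚ

rightEnd : (l : ℕ) {n : ℕ} → Word n → ℚ
rightEnd l ω = applyWord l ω 1ℚ

allWords : (n m : ℕ) → List (Word n)
allWords n zero    = [] ∷ []
allWords n (suc m) = concatMap (λ d → map (d ∷_) (allWords n m)) (allFin n)

minOf : List ℚ → ℚ
minOf []       = 0ℚ
minOf (x ∷ xs) = foldr _⊓_ x xs

maxOf : List ℚ → ℚ
maxOf []       = 0ℚ
maxOf (x ∷ xs) = foldr _⊔_ x xs

-- The cluster of type (i,k) with prefix τ ∈ I^{k-i} is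
--   ⋃_{ω ∈ I^i} φ_τ ∘ φ_ω ([0,1]);
-- clusterMin / clusterMax are its least and greatest points.
clusterMin : (l n : ℕ) → Word n → (i : ℕ) → ℚ
clusterMin l n τ i = minOf (map (λ ω → leftEnd l (τ ++ ω)) (allWords n i))

clusterMax : (l n : ℕ) → Word n → (i : ℕ) → ℚ
clusterMax l n τ i = maxOf (map (λ ω → rightEnd l (τ ++ ω)) (allWords n i))

-- Length of the gap of type (i,k) separating the consecutive type-(i,k) clusters
-- with prefixes τ j and τ j' (j' = j+1) inside the type-(i+1,k) cluster with prefix τ.
gapLength : (l n : ℕ) → Word n → (j j' : Fin n) → (i : ℕ) → ℚ
gapLength l n τ j j' i = clusterMin l n (τ ++ (j' ∷ [])) i - clusterMax l n (τ ++ (j ∷ [])) i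

-- Length of the gap of type (k,k): between O_k (the type-(k,k) cluster) and 1.
lastGapLength : (l n k : ℕ) → ℚ
lastGapLength l n k = 1ℚ - clusterMax l n [] k

formula : (l n k i : ℕ) → ℚ
formula l n k i = ℕtoℚ (l Data.Nat.∸ n) * recip (l ^ k) * ℕtoℚ (sum (map (l ^_) (upTo i)))

-- Every φ_i is increasing and affine with slope 1/l, so the cluster of type (i,k) with
-- prefix σ runs from φ_σ(0) (the word 0⋯0) to φ_σ(t_i), where t_i = φ_{n-1}^i(1) comes from
-- the word (n-1)⋯(n-1). A gap of type (i,k) is thus φ_τ(φ_{j+1}(0)) - φ_τ(φ_j(t_i)), which
-- equals (1 - t_i)/l^{k-i}. Finally g_i = 1 - t_i satisfies g_0 = 0 and
-- g_{i+1} = (l - n + g_i)/l, so g_i = (l - n)(1 + l + ⋯ + l^{i-1})/l^i.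
module Submission where

open import Algebra.Bundles using (CommutativeRing)
open import Data.Fin as Fin using (Fin; toℕ; fromℕ)
import Data.Fin.Properties as Fin
open import Data.Integer as ℤ using (+_)
import Data.Integer.Properties as ℤ
open import Data.List using ([]; _∷_; _++_; map; length; replicate; allFin; upTo; _∷ʳ_)
open import Data.List.Membership.Propositional using (_∈_)
open import Data.List.Membership.Propositional.Properties using (∈-map⁺; ∈-concat⁺′; ∈-concatMap⁻; ∈-map⁻; ∈-allFin)
open import Data.List.Properties using (foldr-preservesᵇ; foldr-preservesᵒ; applyUpTo-∷ʳ; map-++)
open import Data.List.Relation.Unary.All as All using (All; _∷_)
import Data.List.Relation.Unary.All.Properties as All
open import Data.List.Relation.Unary.Any as Any using (here)
open import Data.Nat as ℕ using (ℕ; zero; suc; z≤n; NonZero; _∸_)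
import Data.Nat.Coprimality as Coprime
open import Data.Nat.ListAction using (sum)
open import Data.Nat.ListAction.Properties using (sum-++)
import Data.Nat.Properties as ℕ
open import Data.Product using (_×_; _,_)
open import Data.Rational using (ℚ; mkℚ; 0ℚ; 1ℚ; _+_; _*_; _-_; _≤_; NonNegative; *≤*)
open import Data.Rational.Properties
open import Data.Rational.Solver using (module +-*-Solver)
open import Function using (_∘′_)
open import Data.Sum using ([_,_])
open import Relation.Binary.PropositionalEquality using (_≡_; refl; sym; trans; cong; cong₂; subst; subst₂; module ≡-Reasoning)

open import Defs

open import Algebra.Properties.Semiring.Exp (CommutativeRing.semiring +-*-commutativeRing)
  using (_^_; ^-homo-*)
open +-*-Solver

ℕtoℚ≡mkℚ : ∀ m → ℕtoℚ m ≡ mkℚ (+ m) 0 (Coprime.sym (Coprime.1-coprimeTo m))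
ℕtoℚ≡mkℚ m = ↥p/↧p≡p _

ℕtoℚ-+ : ∀ a b → ℕtoℚ (a ℕ.+ b) ≡ ℕtoℚ a + ℕtoℚ b
ℕtoℚ-+ a b rewrite ℕtoℚ≡mkℚ a | ℕtoℚ≡mkℚ b =
  /-cong (trans (ℤ.pos-+ a b) (sym (cong₂ ℤ._+_ (ℤ.*-identityʳ (+ a)) (ℤ.*-identityʳ (+ b))))) refl

ℕtoℚ-* : ∀ a b → ℕtoℚ (a ℕ.* b) ≡ ℕtoℚ a * ℕtoℚ b
ℕtoℚ-* a b rewrite ℕtoℚ≡mkℚ a | ℕtoℚ≡mkℚ b = /-cong (ℤ.pos-* a b) refl

ℕtoℚ-^ : ∀ a k → ℕtoℚ (a ℕ.^ k) ≡ ℕtoℚ a ^ k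
ℕtoℚ-^ a zero    = refl
ℕtoℚ-^ a (suc k) = trans (ℕtoℚ-* a (a ℕ.^ k)) (cong (ℕtoℚ a *_) (ℕtoℚ-^ a k))

ℕtoℚ-mono-≤ : ∀ {a b} → a ℕ.≤ b → ℕtoℚ a ≤ ℕtoℚ b
ℕtoℚ-mono-≤ {a} {b} a≤b rewrite ℕtoℚ≡mkℚ a | ℕtoℚ≡mkℚ b =
  *≤* (subst₂ ℤ._≤_ (sym (ℤ.*-identityʳ (+ a))) (sym (ℤ.*-identityʳ (+ b))) (ℤ.+≤+ a≤b))

recip≡mkℚ : ∀ m → recip (suc m) ≡ mkℚ (+ 1) m (Coprime.1-coprimeTo (suc m))
recip≡mkℚ m = ↥p/↧p≡p _

recip-inverse : ∀ m .{{_ : NonZero m}} → recip m * ℕtoℚ m ≡ 1ℚ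
recip-inverse (suc m) rewrite recip≡mkℚ m | ℕtoℚ≡mkℚ (suc m) = *-inverseˡ (mkℚ (+ suc m) 0 (Coprime.sym (Coprime.1-coprimeTo (suc m))))

recip-nonNegative : ∀ m → NonNegative (recip m)
recip-nonNegative zero    = _
recip-nonNegative (suc m) rewrite recip≡mkℚ m = _

^-inverse : ∀ {x y} k → x * y ≡ 1ℚ → x ^ k * y ^ k ≡ 1ℚ
^-inverse         zero    xy≡1 = refl
^-inverse {x} {y} (suc k) xy≡1 = begin
  (x * x ^ k) * (y * y ^ k) ≡⟨ solve 4 (λ x y a b → (x :* a) :* (y :* b) := (x :* y) :* (a :* b)) refl x y (x ^ k) (y ^ k) ⟩
  (x * y) * (x ^ k * y ^ k) ≡⟨ cong₂ _*_ xy≡1 (^-inverse k xy≡1) ⟩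
  1ℚ                        ∎
  where open ≡-Reasoning

inverse-unique : ∀ {x y a} → x * a ≡ 1ℚ → y * a ≡ 1ℚ → x ≡ y
inverse-unique {x} {y} {a} xa≡1 ya≡1 = begin
  x            ≡⟨ sym (*-identityʳ x) ⟩
  x * 1ℚ       ≡⟨ cong (x *_) (sym ya≡1) ⟩
  x * (y * a)  ≡⟨ solve 3 (λ x y a → x :* (y :* a) := (x :* a) :* y) refl x y a ⟩
  (x * a) * y  ≡⟨ cong (_* y) xa≡1 ⟩
  1ℚ * y       ≡⟨ *-identityˡ y ⟩
  y            ∎
  where open ≡-Reasoning

recip-^ : ∀ m k .{{_ : NonZero m}} → recip (m ℕ.^ k) ≡ recip m ^ k
recip-^ m k = inverse-unique (recip-inverse (m ℕ.^ k) {{ℕ.m^n≢0 m k}})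
  (trans (cong (recip m ^ k *_) (ℕtoℚ-^ m k)) (^-inverse k (recip-inverse m)))

sum-upTo-suc : ∀ (f : ℕ → ℕ) i → sum (map f (upTo (suc i))) ≡ sum (map f (upTo i)) ℕ.+ f i
sum-upTo-suc f i = begin
  sum (map f (upTo (suc i)))           ≡⟨ cong (sum ∘′ map f) (sym (applyUpTo-∷ʳ (λ m → m) i)) ⟩
  sum (map f (upTo i ∷ʳ i))            ≡⟨ cong sum (map-++ f (upTo i) _) ⟩
  sum (map f (upTo i) ++ f i ∷ [])     ≡⟨ sum-++ (map f (upTo i)) _ ⟩
  sum (map f (upTo i)) ℕ.+ (f i ℕ.+ 0) ≡⟨ cong (sum (map f (upTo i)) ℕ.+_) (ℕ.+-identityʳ (f i)) ⟩
  sum (map f (upTo i)) ℕ.+ f i         ∎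
  where open ≡-Reasoning

powerSum : ℕ → ℕ → ℕ
powerSum l i = sum (map (l ℕ.^_) (upTo i))

ℕtoℚ-powerSum-suc : ∀ l i → ℕtoℚ (powerSum l (suc i)) ≡ ℕtoℚ (powerSum l i) + ℕtoℚ l ^ i
ℕtoℚ-powerSum-suc l i = begin
  ℕtoℚ (powerSum l (suc i))                 ≡⟨ cong ℕtoℚ (sum-upTo-suc (l ℕ.^_) i) ⟩
  ℕtoℚ (powerSum l i ℕ.+ l ℕ.^ i)           ≡⟨ ℕtoℚ-+ (powerSum l i) (l ℕ.^ i) ⟩
  ℕtoℚ (powerSum l i) + ℕtoℚ (l ℕ.^ i)      ≡⟨ cong (_+_ (ℕtoℚ (powerSum l i))) (ℕtoℚ-^ l i) ⟩
  ℕtoℚ (powerSum l i) + ℕtoℚ l ^ i          ∎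
  where open ≡-Reasoning

maxOf-≡ : ∀ {xs x} → x ∈ xs → All (_≤ x) xs → maxOf xs ≡ x
maxOf-≡ {y ∷ ys} x∈ (y≤x ∷ ys≤x) = ≤-antisym
  (foldr-preservesᵇ ⊔-lub y≤x ys≤x)
  (foldr-preservesᵒ (λ a b → [ (λ x≤a → ≤-trans x≤a (p≤p⊔q a b)) , (λ x≤b → ≤-trans x≤b (p≤q⊔p a b)) ])
    y ys (Any.toSum (Any.map ≤-reflexive x∈)))

minOf-≡ : ∀ {xs x} → x ∈ xs → All (x ≤_) xs → minOf xs ≡ x
minOf-≡ {y ∷ ys} x∈ (x≤y ∷ x≤ys) = ≤-antisym
  (foldr-preservesᵒ (λ a b → [ (λ a≤x → ≤-trans (p⊓q≤p a b) a≤x) , (λ b≤x → ≤-trans (p⊓q≤q a b) b≤x) ])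
    y ys (Any.toSum (Any.map (≤-reflexive ∘′ sym) x∈)))
  (foldr-preservesᵇ ⊓-glb x≤y x≤ys)

applyWord-++ : ∀ l {n} (τ ω : Word n) x → applyWord l (τ ++ ω) x ≡ applyWord l τ (applyWord l ω x)
applyWord-++ l []      ω x = refl
applyWord-++ l (d ∷ τ) ω x = cong (φ l (toℕ d)) (applyWord-++ l τ ω x)

φ-monoʳ-≤ : ∀ l d {x y} → x ≤ y → φ l d x ≤ φ l d y
φ-monoʳ-≤ l d x≤y = *-monoʳ-≤-nonNeg (recip l) {{recip-nonNegative l}} (+-monoˡ-≤ (ℕtoℚ d) x≤y)

φ-monoˡ-≤ : ∀ l {d e} x → d ℕ.≤ e → φ l d x ≤ φ l e x
φ-monoˡ-≤ l x d≤e = *-monoʳ-≤-nonNeg (recip l) {{recip-nonNegative l}} (+-monoʳ-≤ x (ℕtoℚ-mono-≤ d≤e))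

φ-suc-0-gap : ∀ l j x → φ l (suc j) 0ℚ - φ l j x ≡ (1ℚ - x) * recip l
φ-suc-0-gap l j x = begin
  (0ℚ + ℕtoℚ (1 ℕ.+ j)) * r - (x + J) * r ≡⟨ cong (λ y → (0ℚ + y) * r - (x + J) * r) (ℕtoℚ-+ 1 j) ⟩
  (0ℚ + (1ℚ + J)) * r - (x + J) * r       ≡⟨ solve 4 (λ o J x r → (con 0ℚ :+ (o :+ J)) :* r :- (x :+ J) :* r := (o :- x) :* r) refl 1ℚ J x r ⟩
  (1ℚ - x) * r                            ∎
  where
  open ≡-Reasoning
  r = recip l
  J = ℕtoℚ j

applyWord-mono-≤ : ∀ l {n} (τ : Word n) {x y} → x ≤ y → applyWord l τ x ≤ applyWord l τ y
applyWord-mono-≤ l []      x≤y = x≤y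
applyWord-mono-≤ l (d ∷ τ) x≤y = φ-monoʳ-≤ l (toℕ d) (applyWord-mono-≤ l τ x≤y)

applyWord-zeros-≤ : ∀ l {n} (ω : Word (suc n)) x → applyWord l (replicate (length ω) (Fin.zero {n})) x ≤ applyWord l ω x
applyWord-zeros-≤ l []      x = ≤-refl
applyWord-zeros-≤ l (d ∷ ω) x =
  ≤-trans (φ-monoʳ-≤ l 0 (applyWord-zeros-≤ l ω x)) (φ-monoˡ-≤ l (applyWord l ω x) (z≤n {toℕ d}))

applyWord-≤-tops : ∀ l {n} (ω : Word (suc n)) x → applyWord l ω x ≤ applyWord l (replicate (length ω) (fromℕ n)) x
applyWord-≤-tops l []      x = ≤-refl
applyWord-≤-tops l {n} (d ∷ ω) x =
  ≤-trans (φ-monoʳ-≤ l (toℕ d) (applyWord-≤-tops l ω x)) (φ-monoˡ-≤ l (applyWord l (replicate (length ω) (fromℕ n)) x) (Fin.≤fromℕ d))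

leftEnd-zeros : ∀ l {n} i → leftEnd l (replicate i (Fin.zero {n})) ≡ 0ℚ
leftEnd-zeros l zero    = refl
leftEnd-zeros l (suc i) = trans (cong (φ l 0) (leftEnd-zeros l i)) (*-zeroˡ (recip l))

applyWord-difference : ∀ l {n} (τ : Word n) a b →
  applyWord l τ a - applyWord l τ b ≡ (a - b) * recip l ^ length τ
applyWord-difference l []      a b = sym (*-identityʳ (a - b))
applyWord-difference l (d ∷ τ) a b = begin
  (A + D) * r - (B + D) * r         ≡⟨ solve 4 (λ A B D r → (A :+ D) :* r :- (B :+ D) :* r := (A :- B) :* r) refl A B D r ⟩
  (A - B) * r                       ≡⟨ cong (_* r) (applyWord-difference l τ a b) ⟩
  (a - b) * r ^ length τ * r        ≡⟨ solve 3 (λ x p r → x :* p :* r := x :* (r :* p)) refl (a - b) (r ^ length τ) r ⟩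
  (a - b) * (r * r ^ length τ)      ∎
  where
  open ≡-Reasoning
  r = recip l
  A = applyWord l τ a
  B = applyWord l τ b
  D = ℕtoℚ (toℕ d)

length-∈-allWords : ∀ {n} i {ω : Word n} → ω ∈ allWords n i → length ω ≡ i
length-∈-allWords zero    (here refl) = refl
length-∈-allWords {n} (suc i) ω∈
  with _ , dω∈ ← Any.satisfied (∈-concatMap⁻ (λ d → map (d ∷_) (allWords n i)) {xs = allFin n} ω∈)
  with _ , ω′∈ , refl ← ∈-map⁻ _ dω∈
  = cong suc (length-∈-allWords i ω′∈)

replicate-∈-allWords : ∀ {n} i (d : Fin n) → replicate i d ∈ allWords n i
replicate-∈-allWords zero    d = here refl
replicate-∈-allWords {n} (suc i) d =
  ∈-concat⁺′ (∈-map⁺ (d ∷_) (replicate-∈-allWords i d)) (∈-map⁺ (λ d → map (d ∷_) (allWords n i)) (∈-allFin d))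

clusterMin-≡ : ∀ l {n} (σ : Word (suc n)) i → clusterMin l (suc n) σ i ≡ leftEnd l σ
clusterMin-≡ l {n} σ i = minOf-≡ attained (All.map⁺ (All.tabulate (λ {ω} _ → below ω)))
  where
  endOf : Word (suc n) → ℚ
  endOf ω = leftEnd l (σ ++ ω)

  attained : leftEnd l σ ∈ map endOf (allWords (suc n) i)
  attained = subst (_∈ map endOf (allWords (suc n) i))
    (trans (applyWord-++ l σ _ 0ℚ) (cong (applyWord l σ) (leftEnd-zeros l i)))
    (∈-map⁺ endOf (replicate-∈-allWords i Fin.zero))

  below : ∀ ω → leftEnd l σ ≤ endOf ω
  below ω = begin
    applyWord l σ 0ℚ
      ≡⟨ cong (applyWord l σ) (leftEnd-zeros l (length ω)) ⟨
    applyWord l σ (leftEnd l (replicate (length ω) Fin.zero))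
      ≤⟨ applyWord-mono-≤ l σ (applyWord-zeros-≤ l ω 0ℚ) ⟩
    applyWord l σ (leftEnd l ω)
      ≡⟨ applyWord-++ l σ ω 0ℚ ⟨
    endOf ω ∎
    where open ≤-Reasoning

clusterMax-≡ : ∀ l {n} (σ : Word (suc n)) i →
  clusterMax l (suc n) σ i ≡ applyWord l σ (rightEnd l (replicate i (fromℕ n)))
clusterMax-≡ l {n} σ i = maxOf-≡ attained (All.map⁺ (All.tabulate above))
  where
  endOf : Word (suc n) → ℚ
  endOf ω = rightEnd l (σ ++ ω)

  attained : applyWord l σ (rightEnd l (replicate i (fromℕ n))) ∈ map endOf (allWords (suc n) i)
  attained = subst (_∈ map endOf (allWords (suc n) i)) (applyWord-++ l σ _ 1ℚ)
    (∈-map⁺ endOf (replicate-∈-allWords i (fromℕ n)))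

  above : ∀ {ω} → ω ∈ allWords (suc n) i → endOf ω ≤ applyWord l σ (rightEnd l (replicate i (fromℕ n)))
  above {ω} ω∈ = begin
    endOf ω
      ≡⟨ applyWord-++ l σ ω 1ℚ ⟩
    applyWord l σ (rightEnd l ω)
      ≤⟨ applyWord-mono-≤ l σ (applyWord-≤-tops l ω 1ℚ) ⟩
    applyWord l σ (rightEnd l (replicate (length ω) (fromℕ n)))
      ≡⟨ cong (λ m → applyWord l σ (rightEnd l (replicate m (fromℕ n)))) (length-∈-allWords i ω∈) ⟩
    applyWord l σ (rightEnd l (replicate i (fromℕ n))) ∎
    where open ≤-Reasoning

module _ (l : ℕ) .{{_ : NonZero l}} {m} (d : Fin m) (d<l : toℕ d ℕ.< l) where
  private
    r = recip l
    L = ℕtoℚ l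
    D = ℕtoℚ (toℕ d)
    c = ℕtoℚ (l ∸ suc (toℕ d))
    S = λ i → ℕtoℚ (powerSum l i)
    orbit = λ i → rightEnd l (replicate i d)

    L-split : L ≡ c + (1ℚ + D)
    L-split = begin
      L                                        ≡⟨ cong ℕtoℚ (ℕ.m∸n+n≡m d<l) ⟨
      ℕtoℚ (l ∸ suc (toℕ d) ℕ.+ suc (toℕ d))   ≡⟨ ℕtoℚ-+ (l ∸ suc (toℕ d)) (suc (toℕ d)) ⟩
      c + ℕtoℚ (1 ℕ.+ toℕ d)                   ≡⟨ cong (_+_ c) (ℕtoℚ-+ 1 (toℕ d)) ⟩
      c + (1ℚ + D)                             ∎
      where open ≡-Reasoning

  one-minus-φ : ∀ x → 1ℚ - φ l (toℕ d) x ≡ (c + (1ℚ - x)) * r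
  one-minus-φ x = begin
    1ℚ - (x + D) * r                 ≡⟨ cong (_- (x + D) * r) (recip-inverse l) ⟨
    r * L - (x + D) * r              ≡⟨ cong (λ y → r * y - (x + D) * r) L-split ⟩
    r * (c + (1ℚ + D)) - (x + D) * r ≡⟨ solve 5 (λ r c o D x → r :* (c :+ (o :+ D)) :- (x :+ D) :* r := (c :+ (o :- x)) :* r) refl r c 1ℚ D x ⟩
    (c + (1ℚ - x)) * r               ∎
    where open ≡-Reasoning

  one-minus-iterate-scaled : ∀ i → (1ℚ - orbit i) * L ^ i ≡ c * S i
  one-minus-iterate-scaled zero    = trans (cong (_* 1ℚ) (+-inverseʳ 1ℚ)) (sym (*-zeroʳ c))
  one-minus-iterate-scaled (suc i) = begin
    (1ℚ - φ l (toℕ d) (orbit i)) * (L * L ^ i) ≡⟨ cong (_* (L * L ^ i)) (one-minus-φ (orbit i)) ⟩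
    (c + g) * r * (L * L ^ i)                ≡⟨ solve 5 (λ c g r L P → (c :+ g) :* r :* (L :* P) := (c :* P :+ g :* P) :* (r :* L)) refl c g r L (L ^ i) ⟩
    (c * L ^ i + g * L ^ i) * (r * L)        ≡⟨ cong₂ (λ y z → (c * L ^ i + y) * z) (one-minus-iterate-scaled i) (recip-inverse l) ⟩
    (c * L ^ i + c * S i) * 1ℚ               ≡⟨ solve 3 (λ c P S → (c :* P :+ c :* S) :* con 1ℚ := c :* (S :+ P)) refl c (L ^ i) (S i) ⟩
    c * (S i + L ^ i)                        ≡⟨ cong (c *_) (ℕtoℚ-powerSum-suc l i) ⟨
    c * S (suc i)                            ∎
    where
    open ≡-Reasoning
    g = 1ℚ - orbit i

  one-minus-iterate : ∀ i → 1ℚ - orbit i ≡ c * S i * r ^ i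
  one-minus-iterate i = begin
    1ℚ - orbit i                          ≡⟨ *-identityʳ (1ℚ - orbit i) ⟨
    (1ℚ - orbit i) * 1ℚ                   ≡⟨ cong ((1ℚ - orbit i) *_) (^-inverse i (trans (*-comm L r) (recip-inverse l))) ⟨
    (1ℚ - orbit i) * (L ^ i * r ^ i)      ≡⟨ *-assoc (1ℚ - orbit i) (L ^ i) (r ^ i) ⟨
    (1ℚ - orbit i) * L ^ i * r ^ i        ≡⟨ cong (_* r ^ i) (one-minus-iterate-scaled i) ⟩
    c * S i * r ^ i                     ∎
    where open ≡-Reasoning

module _ (l : ℕ) .{{_ : NonZero l}} (n′ : ℕ) (n′<l : n′ ℕ.< l) where
  private
    r = recip l
    c = ℕtoℚ (l ∸ suc n′)
    S = λ i → ℕtoℚ (powerSum l i)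
    top = λ i → rightEnd l (replicate i (fromℕ n′))

  one-minus-rightEnd-tops : ∀ i → 1ℚ - top i ≡ c * S i * r ^ i
  one-minus-rightEnd-tops i = subst (λ e → 1ℚ - top i ≡ ℕtoℚ (l ∸ suc e) * S i * r ^ i) (Fin.toℕ-fromℕ n′)
    (one-minus-iterate l (fromℕ n′) (subst (ℕ._< l) (sym (Fin.toℕ-fromℕ n′)) n′<l) i)

  gapLength-≡ : ∀ i (τ : Word (suc n′)) (j j′ : Fin (suc n′)) → toℕ j′ ≡ suc (toℕ j) →
    gapLength l (suc n′) τ j j′ i ≡ c * r ^ (i ℕ.+ suc (length τ)) * S i
  gapLength-≡ i τ j j′ j′≡1+j = begin
    clusterMin l (suc n′) (τ ++ j′ ∷ []) i - clusterMax l (suc n′) (τ ++ j ∷ []) i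
      ≡⟨ cong₂ _-_ (trans (clusterMin-≡ l (τ ++ j′ ∷ []) i) (applyWord-++ l τ (j′ ∷ []) 0ℚ))
                   (trans (clusterMax-≡ l (τ ++ j ∷ []) i) (applyWord-++ l τ (j ∷ []) (top i))) ⟩
    applyWord l τ (φ l (toℕ j′) 0ℚ) - applyWord l τ (φ l (toℕ j) (top i))
      ≡⟨ applyWord-difference l τ _ _ ⟩
    (φ l (toℕ j′) 0ℚ - φ l (toℕ j) (top i)) * r ^ t
      ≡⟨ cong (λ e → (φ l e 0ℚ - φ l (toℕ j) (top i)) * r ^ t) j′≡1+j ⟩
    (φ l (suc (toℕ j)) 0ℚ - φ l (toℕ j) (top i)) * r ^ t
      ≡⟨ cong (_* r ^ t) (trans (φ-suc-0-gap l (toℕ j) (top i)) (cong (_* r) (one-minus-rightEnd-tops i))) ⟩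
    c * S i * r ^ i * r * r ^ t
      ≡⟨ solve 5 (λ c S P r Q → c :* S :* P :* r :* Q := c :* (P :* (r :* Q)) :* S) refl c (S i) (r ^ i) r (r ^ t) ⟩
    c * (r ^ i * r ^ suc t) * S i
      ≡⟨ cong (λ y → c * y * S i) (^-homo-* r i (suc t)) ⟨
    c * r ^ (i ℕ.+ suc t) * S i ∎
    where
    open ≡-Reasoning
    t = length τ

  lastGapLength-≡ : ∀ k → lastGapLength l (suc n′) k ≡ c * r ^ k * S k
  lastGapLength-≡ k = begin
    1ℚ - clusterMax l (suc n′) [] k ≡⟨ cong (1ℚ -_) (clusterMax-≡ l [] k) ⟩
    1ℚ - top k                      ≡⟨ one-minus-rightEnd-tops k ⟩
    c * S k * r ^ k                 ≡⟨ solve 3 (λ c S P → c :* S :* P := c :* P :* S) refl c (S k) (r ^ k) ⟩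
    c * r ^ k * S k                 ∎
    where open ≡-Reasoning

formula-≡ : ∀ l n k i .{{_ : NonZero l}} →
  formula l n k i ≡ ℕtoℚ (l ∸ n) * recip l ^ k * ℕtoℚ (powerSum l i)
formula-≡ l n k i = cong (λ y → ℕtoℚ (l ∸ n) * y * ℕtoℚ (powerSum l i)) (recip-^ l k)

lemma3p4 : (l n : ℕ) → 2 ℕ.≤ n → n ℕ.< l → (k : ℕ) → 1 ℕ.≤ k →
    ((i : ℕ) → 1 ℕ.≤ i → i ℕ.< k →
    (τ : Word n) → length τ ≡ k ∸ suc i →
    (j j' : Fin n) → toℕ j' ≡ suc (toℕ j) →
    gapLength l n τ j j' i ≡ formula l n k i)
    × (lastGapLength l n k ≡ formula l n k k)
lemma3p4 l (suc n′) _ n<l k _ = typeIK , typeKK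
  where
  instance
    l≢0 : NonZero l
    l≢0 = ℕ.>-nonZero (ℕ.<-trans ℕ.z<s n<l)

  typeIK : ∀ i → 1 ℕ.≤ i → i ℕ.< k → (τ : Word (suc n′)) → length τ ≡ k ∸ suc i →
    (j j′ : Fin (suc n′)) → toℕ j′ ≡ suc (toℕ j) → gapLength l (suc n′) τ j j′ i ≡ formula l (suc n′) k i
  typeIK i _ i<k τ |τ|≡ j j′ j′≡1+j = begin
    gapLength l (suc n′) τ j j′ i                ≡⟨ gapLength-≡ l n′ (ℕ.<⇒≤ n<l) i τ j j′ j′≡1+j ⟩
    c * recip l ^ (i ℕ.+ suc (length τ)) * S     ≡⟨ cong (λ e → c * recip l ^ e * S) i+1+|τ|≡k ⟩
    c * recip l ^ k * S                          ≡⟨ formula-≡ l (suc n′) k i ⟨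
    formula l (suc n′) k i                       ∎
    where
    open ≡-Reasoning
    c = ℕtoℚ (l ∸ suc n′)
    S = ℕtoℚ (powerSum l i)
    i+1+|τ|≡k : i ℕ.+ suc (length τ) ≡ k
    i+1+|τ|≡k = trans (ℕ.+-suc i (length τ)) (trans (cong (suc i ℕ.+_) |τ|≡) (ℕ.m+[n∸m]≡n i<k))

  typeKK : lastGapLength l (suc n′) k ≡ formula l (suc n′) k k
  typeKK = trans (lastGapLength-≡ l n′ (ℕ.<⇒≤ n<l) k) (sym (formula-≡ l (suc n′) k k))
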